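{- Let $r\geq 3$ be an integer and $c>0$ a real number. If $G$ is a graph of order $n$ with minimum degree \[ \delta(G)>\left(\frac{r-1}{r}+c\right)n, \] then \[ k_{r+1}(G)>c\,\frac{r}{r+1}\left(\frac{n}{r}\right)^{r+1} \qquad\text{and}\qquad js^{(2,r+1,2)}(G)>c\left(\frac{n}{r}\right)^{r-2}. \]
   Context: All graphs are finite and simple. $\delta(G)$ is the minimum degree of $G$. $k_{s}(G)$ denotes the number of $s$-cliques of $G$. For a graph $G$, $js^{(2,r+1,2)}(G)$ is the maximum, over all edges $uv$ of $G$, of the number of $(r+1)$-cliques of $G$ containing both $u$ and $v$ (and $0$ if $G$ has no edges).
   Formalization: The constant c ranges over the positive rationals rather than the positive reals. -}

module Defs where

open import Data.Bool using (Bool; true; false; _∧_; if_then_else_)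
open import Data.Nat using (ℕ; zero; suc; _⊔_)
open import Data.Fin using (Fin; _≟_)
open import Data.Fin.Subset using (Subset; ∣_∣)
open import Data.List using (List; []; _∷_; map; length; filterᵇ; allFin; foldr; concatMap)
open import Data.Vec using (Vec; []; _∷_; lookup)
open import Data.Integer using (+_)
open import Data.Rational using (ℚ; _/_; _*_; 1ℚ)
open import Relation.Binary.PropositionalEquality using (_≡_)
open import Relation.Nullary using (¬_; does)

record Graph (n : ℕ) : Set where
  field
    adj   : Fin n → Fin n → Bool
    sym   : ∀ u v → adj u v ≡ adj v u
    irrefl : ∀ v → adj v v ≡ false
open Graph public

degree : ∀ {n} → Graph n → Fin n → ℕ
degree G v = length (filterᵇ (adj G v) (allFin n))
  where n = _

allSubsets : (n : ℕ) → List (Subset n)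
allSubsets zero = [] ∷ []
allSubsets (suc n) = concatMap (λ S → (true ∷ S) ∷ (false ∷ S) ∷ []) (allSubsets n)

allB : ∀ {A : Set} → (A → Bool) → List A → Bool
allB p = foldr (λ x b → p x ∧ b) true

isClique : ∀ {n} → Graph n → Subset n → Bool
isClique {n} G S =
  allB (λ u → allB (λ v →
        if lookup S u ∧ lookup S v ∧ Data.Bool.not (does (u ≟ v))
        then adj G u v else true) (allFin n)) (allFin n)
  where import Data.Bool

hasSize : ∀ {n} → ℕ → Subset n → Bool
hasSize s S = does (∣ S ∣ Data.Nat.≟ s)
  where import Data.Nat

cliqueCount : ∀ {n} → ℕ → Graph n → ℕ
cliqueCount {n} s G =
  length (filterᵇ (λ S → hasSize s S ∧ isClique G S) (allSubsets n))

cliqueCountThrough : ∀ {n} → ℕ → Graph n → Fin n → Fin n → ℕ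
cliqueCountThrough {n} s G u v =
  length (filterᵇ (λ S → lookup S u ∧ lookup S v ∧ hasSize s S ∧ isClique G S)
                  (allSubsets n))

-- js^{(2,r+1,2)}(G): max over edges uv of the number of (r+1)-cliques
-- containing u and v; 0 if G has no edges.
js : ∀ {n} → ℕ → Graph n → ℕ
js {n} r G =
  foldr _⊔_ 0
    (concatMap (λ u → map (λ v → if adj G u v then cliqueCountThrough (suc r) G u v else 0)
                          (allFin n))
               (allFin n))

ℕ→ℚ : ℕ → ℚ
ℕ→ℚ a = + a / 1

-- a / b as a rational (only used with b ≠ 0; set to 0 when b = 0)
frac : ℕ → ℕ → ℚ
frac a zero = + 0 / 1
frac a (suc b) = + a / suc b

pow : ℚ → ℕ → ℚ
pow q zero = 1ℚ
pow q (suc k) = q * pow q k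

{-# OPTIONS --safe #-}

-- Write D = n − δ(G). Every vertex is non-adjacent to at most D vertices (itself included),
-- so a clique K has at least n − |K|·D common neighbours, and the hypothesis on δ(G) reads
-- r·c·n < n − r·D. Counting pairs (w, T) with w ∉ K and T an s-clique containing K ∪ {w}
-- gives Σ_{w ∉ K} N(K ∪ {w}) = (s − |K|)·N(K), where N(K) is the number of s-cliques
-- containing K; by induction m!·N(K) ≥ ∏_{i<m} (n − (|K| + i)·D) whenever |K| + m = s.
-- For s = r + 1 and K = ∅ or an edge, every factor with |K| + i < r is at least
-- n·(r − |K| − i)/r because r·D < n, while the last factor n − r·D exceeds r·c·n;
-- clearing denominators gives both bounds.

module Submission where

open import Data.Nat using (ℕ)
open import Defs using (Graph)

module Counting where

  open import Data.Nat.Properties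
  open import Algebra.Properties.Semiring.Sum +-*-semiring public
    using (sum; sum-syntax; ∑-distrib-+; ∑-comm; *-distribˡ-sum; *-distribʳ-sum; sum-cong-≗; sum-remove;
           sum-replicate-zero)
  open import Defs using (allB)
  open import Data.Bool using (Bool; true; false; not; _∧_; _∨_)
  open import Data.Fin using (Fin; zero; suc)
  open import Data.List using ([]; _∷_; map; length; filterᵇ; tabulate; foldr)
  open import Data.List.Membership.Propositional using (_∈_)
  open import Data.List.Relation.Unary.Any using (here; there)
  open import Data.Nat using (ℕ; zero; suc; _+_; _*_; _≤_; _<_; _⊔_; z≤n)
  open import Data.Nat.ListAction renaming (sum to sumˡ)
  open import Data.Product using (∃; _,_; _×_; proj₁; proj₂)
  open import Relation.Binary.PropositionalEquality

  private
    variable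
      A : Set
      m n : ℕ

  ⟦_⟧ : Bool → ℕ
  ⟦ true ⟧ = 1
  ⟦ false ⟧ = 0

  ⟦∧⟧ : ∀ a b → ⟦ a ∧ b ⟧ ≡ ⟦ a ⟧ * ⟦ b ⟧
  ⟦∧⟧ true b = sym (+-identityʳ ⟦ b ⟧)
  ⟦∧⟧ false b = refl

  ⟦not⟧+⟦⟧≡1 : ∀ b → ⟦ not b ⟧ + ⟦ b ⟧ ≡ 1
  ⟦not⟧+⟦⟧≡1 true = refl
  ⟦not⟧+⟦⟧≡1 false = refl

  ⟦∧⟧≤⟦⟧ : ∀ a b → ⟦ a ∧ b ⟧ ≤ ⟦ a ⟧
  ⟦∧⟧≤⟦⟧ true true = ≤-refl
  ⟦∧⟧≤⟦⟧ true false = z≤n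
  ⟦∧⟧≤⟦⟧ false b = ≤-refl

  ⟦⟧*-congʳ : ∀ b {x y} → (b ≡ true → x ≡ y) → ⟦ b ⟧ * x ≡ ⟦ b ⟧ * y
  ⟦⟧*-congʳ true x≡y = cong (_+ 0) (x≡y refl)
  ⟦⟧*-congʳ false x≡y = refl

  ⟦⟧*-monoʳ-≤ : ∀ b {x y} → (b ≡ true → x ≤ y) → ⟦ b ⟧ * x ≤ ⟦ b ⟧ * y
  ⟦⟧*-monoʳ-≤ true x≤y = +-monoˡ-≤ 0 (x≤y refl)
  ⟦⟧*-monoʳ-≤ false x≤y = z≤n

  ∧≡true : ∀ {a b} → a ∧ b ≡ true → a ≡ true × b ≡ true
  ∧≡true {true} b≡true = refl , b≡true

  not-∨-elim : ∀ {a b} → not a ∨ b ≡ true → a ≡ true → b ≡ true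
  not-∨-elim b≡true refl = b≡true

  not-∨≡false : ∀ {a b} → not a ∨ b ≡ false → a ≡ true × b ≡ false
  not-∨≡false {true} b≡false = refl , b≡false

  allB-complete : ∀ (p : A → Bool) xs → (∀ x → p x ≡ true) → allB p xs ≡ true
  allB-complete p [] _ = refl
  allB-complete p (x ∷ xs) all rewrite all x = allB-complete p xs all

  allB-sound : ∀ (p : A → Bool) {xs x} → allB p xs ≡ true → x ∈ xs → p x ≡ true
  allB-sound p {y ∷ xs} all (here refl) = proj₁ (∧≡true all)
  allB-sound p {y ∷ xs} all (there x∈xs) = allB-sound p (proj₂ (∧≡true all)) x∈xs

  allB-false : ∀ (p : A → Bool) xs → allB p xs ≡ false → ∃ λ x → p x ≡ false
  allB-false p (x ∷ xs) all with p x in px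
  ... | false = x , px
  ... | true = allB-false p xs all

  ∑-mono-≤ : {f g : Fin n → ℕ} → (∀ i → f i ≤ g i) → ∑[ i < n ] f i ≤ ∑[ i < n ] g i
  ∑-mono-≤ {zero} f≤g = z≤n
  ∑-mono-≤ {suc n} f≤g = +-mono-≤ (f≤g zero) (∑-mono-≤ (λ i → f≤g (suc i)))

  term≤∑ : ∀ (f : Fin n → ℕ) i → f i ≤ ∑[ j < n ] f j
  term≤∑ {suc n} f i = subst (f i ≤_) (sym (sum-remove {i = i} f)) (m≤m+n (f i) _)

  ∑[1]≡n : ∀ n → ∑[ i < n ] 1 ≡ n
  ∑[1]≡n zero = refl
  ∑[1]≡n (suc n) = cong suc (∑[1]≡n n)

  ∑⟦not⟧+∑⟦⟧≡n : ∀ (p : Fin n → Bool) → ∑[ i < n ] ⟦ not (p i) ⟧ + ∑[ i < n ] ⟦ p i ⟧ ≡ n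
  ∑⟦not⟧+∑⟦⟧≡n {n} p = begin
    ∑[ i < n ] ⟦ not (p i) ⟧ + ∑[ i < n ] ⟦ p i ⟧ ≡⟨ ∑-distrib-+ (λ i → ⟦ not (p i) ⟧) (λ i → ⟦ p i ⟧) ⟨
    ∑[ i < n ] (⟦ not (p i) ⟧ + ⟦ p i ⟧)         ≡⟨ sum-cong-≗ (λ i → ⟦not⟧+⟦⟧≡1 (p i)) ⟩
    ∑[ i < n ] 1                                  ≡⟨ ∑[1]≡n n ⟩
    n                                             ∎
    where open ≡-Reasoning

  length-filterᵇ : ∀ (p : A → Bool) xs → length (filterᵇ p xs) ≡ sumˡ (map (λ x → ⟦ p x ⟧) xs)
  length-filterᵇ p [] = refl
  length-filterᵇ p (x ∷ xs) with p x
  ... | true = cong suc (length-filterᵇ p xs)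
  ... | false = length-filterᵇ p xs

  filterᵇ-nonempty : ∀ (p : A → Bool) xs → 0 < length (filterᵇ p xs) → ∃ λ x → p x ≡ true
  filterᵇ-nonempty p (x ∷ xs) 0<len with p x in px
  ... | true = x , px
  ... | false = filterᵇ-nonempty p xs 0<len

  sum-map-tabulate : ∀ (f : A → ℕ) (g : Fin n → A) → sumˡ (map f (tabulate g)) ≡ ∑[ i < n ] f (g i)
  sum-map-tabulate {n = zero} f g = refl
  sum-map-tabulate {n = suc n} f g = cong (f (g zero) +_) (sum-map-tabulate f (λ i → g (suc i)))

  *-distribˡ-sum-map : ∀ k (f : A → ℕ) xs → k * sumˡ (map f xs) ≡ sumˡ (map (λ x → k * f x) xs)
  *-distribˡ-sum-map k f [] = *-zeroʳ k
  *-distribˡ-sum-map k f (x ∷ xs) =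
    trans (*-distribˡ-+ k (f x) _) (cong (k * f x +_) (*-distribˡ-sum-map k f xs))

  sum-map-∑-comm : ∀ (f : A → Fin m → ℕ) xs →
    sumˡ (map (λ x → ∑[ i < m ] f x i) xs) ≡ ∑[ i < m ] sumˡ (map (λ x → f x i) xs)
  sum-map-∑-comm {m = m} f [] = sym (sum-replicate-zero m)
  sum-map-∑-comm f (x ∷ xs) =
    trans (cong (sum (f x) +_) (sum-map-∑-comm f xs)) (sym (∑-distrib-+ (f x) _))

  ∈⇒≤sum-map : ∀ (f : A → ℕ) {x xs} → x ∈ xs → f x ≤ sumˡ (map f xs)
  ∈⇒≤sum-map f (here refl) = m≤m+n _ _
  ∈⇒≤sum-map f (there x∈xs) = ≤-trans (∈⇒≤sum-map f x∈xs) (m≤n+m _ _)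

  ∈⇒≤foldr-⊔ : ∀ {x xs} → x ∈ xs → x ≤ foldr _⊔_ 0 xs
  ∈⇒≤foldr-⊔ {xs = y ∷ _} (here refl) = m≤m⊔n y _
  ∈⇒≤foldr-⊔ {xs = y ∷ _} (there x∈xs) = ≤-trans (∈⇒≤foldr-⊔ x∈xs) (m≤n⊔m y _)

module Subsets where

  open import Defs using (allSubsets; hasSize)
  open Counting
  open import Data.Bool using (Bool; true; false; not; _∧_; _∨_)
  open import Data.Bool.Properties using (∧-assoc; ∧-identityʳ; ∧-zeroʳ; ∨-zeroʳ; T-≡)
  open import Data.Fin using (Fin; zero; suc; _≟_)
  open import Data.Fin.Subset using (Subset; ∣_∣) renaming (⊥ to ∅)
  open import Data.List using (_∷_; [])
  open import Data.List.Membership.Propositional using (_∈_; lose)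
  open import Data.List.Membership.Propositional.Properties using (∈-concatMap⁺)
  open import Data.List.Relation.Unary.Any using (here; there)
  open import Data.Nat using (ℕ; zero; suc; _+_; _*_)
  open import Data.Nat.Properties using (+-suc; ≡ᵇ⇒≡; ≡⇒≡ᵇ)
  open import Data.Sum using (_⊎_; inj₁; inj₂)
  open import Data.Vec using (_∷_; []; lookup; _[_]≔_)
  open import Data.Vec.Properties using (lookup∘update′; lookup-replicate)
  open import Function.Bundles using (Equivalence)
  open import Relation.Binary.PropositionalEquality
  open import Relation.Nullary using (yes; no; contradiction)

  private
    variable
      n : ℕ

  infix 7 _⊆ᵇ_
  _⊆ᵇ_ : Subset n → Subset n → Bool
  [] ⊆ᵇ [] = true
  (x ∷ K) ⊆ᵇ (y ∷ T) = (not x ∨ y) ∧ K ⊆ᵇ T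

  ∣∣≡∑ : ∀ (K : Subset n) → ∣ K ∣ ≡ ∑[ i < n ] ⟦ lookup K i ⟧
  ∣∣≡∑ [] = refl
  ∣∣≡∑ (true ∷ K) = cong suc (∣∣≡∑ K)
  ∣∣≡∑ (false ∷ K) = ∣∣≡∑ K

  ∣[]≔true∣ : ∀ (K : Subset n) w → lookup K w ≡ false → ∣ K [ w ]≔ true ∣ ≡ suc ∣ K ∣
  ∣[]≔true∣ (false ∷ K) zero refl = refl
  ∣[]≔true∣ (true ∷ K) (suc w) w∉K = cong suc (∣[]≔true∣ K w w∉K)
  ∣[]≔true∣ (false ∷ K) (suc w) w∉K = ∣[]≔true∣ K w w∉K

  hasSize-sound : ∀ {s} (T : Subset n) → hasSize s T ≡ true → ∣ T ∣ ≡ s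
  hasSize-sound {s = s} T size = ≡ᵇ⇒≡ ∣ T ∣ s (Equivalence.from T-≡ size)

  hasSize-complete : ∀ {s} (T : Subset n) → ∣ T ∣ ≡ s → hasSize s T ≡ true
  hasSize-complete {s = s} T ∣T∣≡s = Equivalence.to T-≡ (≡⇒≡ᵇ ∣ T ∣ s ∣T∣≡s)

  lookup-[]≔true : ∀ (K : Subset n) w u → lookup (K [ w ]≔ true) u ≡ true → u ≡ w ⊎ lookup K u ≡ true
  lookup-[]≔true K w u u∈ with u ≟ w
  ... | yes u≡w = inj₁ u≡w
  ... | no u≢w = inj₂ (trans (sym (lookup∘update′ u≢w K true)) u∈)

  ∉∅ : ∀ (x : Fin n) → lookup ∅ x ≢ true
  ∉∅ x x∈∅ = contradiction (trans (sym (lookup-replicate x false)) x∈∅) λ ()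

  ∅⊆ᵇ : ∀ (T : Subset n) → ∅ ⊆ᵇ T ≡ true
  ∅⊆ᵇ [] = refl
  ∅⊆ᵇ (y ∷ T) = ∅⊆ᵇ T

  ⊆ᵇ-refl : ∀ (K : Subset n) → K ⊆ᵇ K ≡ true
  ⊆ᵇ-refl [] = refl
  ⊆ᵇ-refl (true ∷ K) = ⊆ᵇ-refl K
  ⊆ᵇ-refl (false ∷ K) = ⊆ᵇ-refl K

  []≔true-⊆ᵇ : ∀ (K T : Subset n) w → (K [ w ]≔ true) ⊆ᵇ T ≡ K ⊆ᵇ T ∧ lookup T w
  []≔true-⊆ᵇ (x ∷ K) (true ∷ T) zero
    rewrite ∨-zeroʳ (not x) = sym (∧-identityʳ (K ⊆ᵇ T))
  []≔true-⊆ᵇ (x ∷ K) (false ∷ T) zero = sym (∧-zeroʳ ((not x ∨ false) ∧ K ⊆ᵇ T))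
  []≔true-⊆ᵇ (x ∷ K) (y ∷ T) (suc w) rewrite []≔true-⊆ᵇ K T w =
    sym (∧-assoc (not x ∨ y) (K ⊆ᵇ T) (lookup T w))

  pair-⊆ᵇ : ∀ u v (T : Subset n) → (∅ [ u ]≔ true [ v ]≔ true) ⊆ᵇ T ≡ lookup T u ∧ lookup T v
  pair-⊆ᵇ u v T = trans ([]≔true-⊆ᵇ (∅ [ u ]≔ true) T v)
    (cong (_∧ lookup T v) (trans ([]≔true-⊆ᵇ ∅ T u) (cong (_∧ lookup T u) (∅⊆ᵇ T))))

  ⊆ᵇ⇒∑+∣∣≡∣∣ : ∀ (K T : Subset n) → K ⊆ᵇ T ≡ true →
    ∑[ w < n ] (⟦ not (lookup K w) ⟧ * ⟦ lookup T w ⟧) + ∣ K ∣ ≡ ∣ T ∣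
  ⊆ᵇ⇒∑+∣∣≡∣∣ [] [] _ = refl
  ⊆ᵇ⇒∑+∣∣≡∣∣ (true ∷ K) (true ∷ T) K⊆T = trans (+-suc _ _) (cong suc (⊆ᵇ⇒∑+∣∣≡∣∣ K T K⊆T))
  ⊆ᵇ⇒∑+∣∣≡∣∣ (false ∷ K) (true ∷ T) K⊆T = cong suc (⊆ᵇ⇒∑+∣∣≡∣∣ K T K⊆T)
  ⊆ᵇ⇒∑+∣∣≡∣∣ (false ∷ K) (false ∷ T) K⊆T = ⊆ᵇ⇒∑+∣∣≡∣∣ K T K⊆T

  ∈-allSubsets : ∀ (S : Subset n) → S ∈ allSubsets n
  ∈-allSubsets [] = here refl
  ∈-allSubsets (b ∷ S) =
    ∈-concatMap⁺ (λ S → (true ∷ S) ∷ (false ∷ S) ∷ []) (lose (∈-allSubsets S) (head-choice b))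
    where
    head-choice : ∀ b → b ∷ S ∈ (true ∷ S) ∷ (false ∷ S) ∷ []
    head-choice true = here refl
    head-choice false = there (here refl)

module StepProduct where

  open import Data.Nat using (ℕ; zero; suc; _+_; _*_; _∸_; _^_; _≤_; _!)
  open import Data.Nat.Properties
  open import Data.Nat.Tactic.RingSolver using (solve-∀)
  open import Relation.Binary.PropositionalEquality

  stepProduct : ℕ → ℕ → ℕ → ℕ → ℕ
  stepProduct n D j zero = 1
  stepProduct n D j (suc m) = (n ∸ j * D) * stepProduct n D (suc j) m

  stepProduct-suc : ∀ n D j m → stepProduct n D j (suc m) ≡ stepProduct n D j m * (n ∸ (j + m) * D)
  stepProduct-suc n D j zero = begin
    (n ∸ j * D) * 1           ≡⟨ *-identityʳ _ ⟩
    n ∸ j * D                 ≡⟨ cong (λ i → n ∸ i * D) (+-identityʳ j) ⟨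
    n ∸ (j + 0) * D           ≡⟨ *-identityˡ _ ⟨
    1 * (n ∸ (j + 0) * D)     ∎
    where open ≡-Reasoning
  stepProduct-suc n D j (suc m) = begin
    (n ∸ j * D) * stepProduct n D (suc j) (suc m)
      ≡⟨ cong ((n ∸ j * D) *_) (stepProduct-suc n D (suc j) m) ⟩
    (n ∸ j * D) * (stepProduct n D (suc j) m * (n ∸ (suc j + m) * D))
      ≡⟨ *-assoc (n ∸ j * D) _ _ ⟨
    (n ∸ j * D) * stepProduct n D (suc j) m * (n ∸ (suc j + m) * D)
      ≡⟨ cong (λ i → (n ∸ j * D) * stepProduct n D (suc j) m * (n ∸ i * D)) (+-suc j m) ⟨
    (n ∸ j * D) * stepProduct n D (suc j) m * (n ∸ (j + suc m) * D) ∎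
    where open ≡-Reasoning

  n*[r∸j]≤r*[n∸j*D] : ∀ {n D r} j → r * D ≤ n → n * (r ∸ j) ≤ r * (n ∸ j * D)
  n*[r∸j]≤r*[n∸j*D] {n} {D} {r} j rD≤n = begin
    n * (r ∸ j)            ≡⟨ *-distribˡ-∸ n r j ⟩
    n * r ∸ n * j          ≡⟨ cong₂ _∸_ (*-comm n r) (*-comm n j) ⟩
    r * n ∸ j * n          ≤⟨ ∸-monoʳ-≤ (r * n) rjD≤jn ⟩
    r * n ∸ r * (j * D)    ≡⟨ *-distribˡ-∸ r n (j * D) ⟨
    r * (n ∸ j * D)        ∎
    where
    open ≤-Reasoning
    x*[y*z]≡y*[x*z] : ∀ x y z → x * (y * z) ≡ y * (x * z)
    x*[y*z]≡y*[x*z] = solve-∀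
    rjD≤jn : r * (j * D) ≤ j * n
    rjD≤jn = begin
      r * (j * D) ≡⟨ x*[y*z]≡y*[x*z] r j D ⟩
      j * (r * D) ≤⟨ *-monoʳ-≤ j rD≤n ⟩
      j * n       ∎

  stepProduct-≥ : ∀ {n D r} j m → j + m ≡ r → r * D ≤ n → n ^ m * m ! ≤ r ^ m * stepProduct n D j m
  stepProduct-≥ j zero _ _ = ≤-refl
  stepProduct-≥ {n} {D} j (suc m) refl rD≤n = begin
    n * n ^ m * (suc m * m !)                             ≡⟨ interchange n (n ^ m) (suc m) (m !) ⟩
    n * suc m * (n ^ m * m !)
      ≡⟨ cong (λ k → n * k * (n ^ m * m !)) (m+n∸m≡n j (suc m)) ⟨
    n * (r ∸ j) * (n ^ m * m !)                           ≤⟨ *-mono-≤ (n*[r∸j]≤r*[n∸j*D] j rD≤n) ih ⟩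
    r * (n ∸ j * D) * (r ^ m * stepProduct n D (suc j) m) ≡⟨ interchange r (n ∸ j * D) (r ^ m) _ ⟩
    r * r ^ m * ((n ∸ j * D) * stepProduct n D (suc j) m) ∎
    where
    open ≤-Reasoning
    r = j + suc m
    interchange : ∀ a b c d → a * b * (c * d) ≡ a * c * (b * d)
    interchange = solve-∀
    ih : n ^ m * m ! ≤ r ^ m * stepProduct n D (suc j) m
    ih = stepProduct-≥ (suc j) m (sym (+-suc j m)) rD≤n

module Cliques {n : ℕ} (G : Graph n) where

  open import Defs hiding (sym)
  open Counting
  open Subsets
  open StepProduct
  open import Data.Bool using (Bool; true; false; not; _∧_; _∨_; if_then_else_)
  open import Data.Bool.Properties using (∧-assoc)
  open import Data.Fin using (Fin; _≟_; fromℕ<)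
  open import Data.Fin.Subset using (Subset; ∣_∣) renaming (⊥ to ∅)
  open import Data.Fin.Subset.Properties using (∣⊥∣≡0)
  open import Data.List using (List; map; allFin)
  open import Data.List.Extrema.Nat using (argmin; f[argmin]≤f[xs])
  open import Data.List.Properties using (map-cong)
  import Data.List.Relation.Unary.All as All
  open import Data.List.Membership.Propositional using (lose)
  open import Data.List.Membership.Propositional.Properties using (∈-allFin; ∈-map⁺; ∈-concatMap⁺)
  open import Data.Nat using (ℕ; zero; suc; _+_; _*_; _∸_; _≤_; _<_; _!; z≤n; s≤s)
  open import Data.Nat.ListAction renaming (sum to sumˡ)
  open import Data.Nat.Properties hiding (_≟_)
  open import Data.Nat.Tactic.RingSolver using (solve-∀)
  open import Data.Product using (∃; _,_; _×_; proj₁; proj₂)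
  open import Data.Sum using (inj₁; inj₂)
  open import Data.Vec using (lookup; _[_]≔_)
  open import Data.Vec.Properties using (lookup-replicate; lookup∘update′)
  open import Relation.Binary.PropositionalEquality
  open import Relation.Nullary using (does; yes; no; contradiction)

  degree≡∑ : ∀ v → degree G v ≡ ∑[ w < n ] ⟦ adj G v w ⟧
  degree≡∑ v =
    trans (length-filterᵇ (adj G v) (allFin n)) (sum-map-tabulate (λ w → ⟦ adj G v w ⟧) (λ w → w))

  degree≤n : ∀ v → degree G v ≤ n
  degree≤n v = subst₂ _≤_ (sym (degree≡∑ v)) (∑⟦not⟧+∑⟦⟧≡n (adj G v)) (m≤n+m _ _)

  nonNeighbours≡ : ∀ v → ∑[ w < n ] ⟦ not (adj G v w) ⟧ ≡ n ∸ degree G v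
  nonNeighbours≡ v = begin
    ∑[ w < n ] ⟦ not (adj G v w) ⟧
      ≡⟨ m+n∸n≡m _ (∑[ w < n ] ⟦ adj G v w ⟧) ⟨
    ∑[ w < n ] ⟦ not (adj G v w) ⟧ + ∑[ w < n ] ⟦ adj G v w ⟧ ∸ ∑[ w < n ] ⟦ adj G v w ⟧
      ≡⟨ cong₂ _∸_ (∑⟦not⟧+∑⟦⟧≡n (adj G v)) (sym (degree≡∑ v)) ⟩
    n ∸ degree G v
      ∎
    where open ≡-Reasoning

  neighbour : ∀ u → 0 < degree G u → ∃ λ v → adj G u v ≡ true
  neighbour u = filterᵇ-nonempty (adj G u) (allFin n)

  IsClique : Subset n → Set
  IsClique K = ∀ {u v} → lookup K u ≡ true → lookup K v ≡ true → u ≢ v → adj G u v ≡ true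

  isClique-complete : ∀ K → IsClique K → isClique G K ≡ true
  isClique-complete K K-clique =
    allB-complete _ (allFin n) λ u → allB-complete _ (allFin n) λ v → adjacent-or-skipped u v
    where
    adjacent-or-skipped : ∀ u v →
      (if lookup K u ∧ lookup K v ∧ not (does (u ≟ v)) then adj G u v else true) ≡ true
    adjacent-or-skipped u v with lookup K u in u∈K | lookup K v in v∈K | u ≟ v
    ... | true | true | no u≢v = K-clique u∈K v∈K u≢v
    ... | true | true | yes _ = refl
    ... | true | false | _ = refl
    ... | false | _ | _ = refl

  ∅-isClique : IsClique ∅
  ∅-isClique {u} u∈∅ = contradiction u∈∅ (∉∅ u)

  IsClique-[]≔true : ∀ {K w} → IsClique K → (∀ {v} → lookup K v ≡ true → adj G v w ≡ true) →
    IsClique (K [ w ]≔ true)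
  IsClique-[]≔true {K} {w} K-clique joins {u} {v} u∈ v∈ u≢v
    with lookup-[]≔true K w u u∈ | lookup-[]≔true K w v v∈
  ... | inj₁ refl | inj₁ refl = contradiction refl u≢v
  ... | inj₁ refl | inj₂ v∈K = trans (Graph.sym G u v) (joins v∈K)
  ... | inj₂ u∈K | inj₁ refl = joins u∈K
  ... | inj₂ u∈K | inj₂ v∈K = K-clique u∈K v∈K u≢v

  commonNeighbour : Subset n → Fin n → Bool
  commonNeighbour K w = not (lookup K w) ∧ allB (λ v → not (lookup K v) ∨ adj G v w) (allFin n)

  commonNeighbour-sound : ∀ K w → commonNeighbour K w ≡ true →
    lookup K w ≡ false × (∀ {v} → lookup K v ≡ true → adj G v w ≡ true)
  commonNeighbour-sound K w cn with lookup K w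
  ... | false = refl , λ {v} v∈K → not-∨-elim (allB-sound _ cn (∈-allFin v)) v∈K

  nonNeighbour⇒1≤∑ : ∀ K {v w} → lookup K v ≡ true → adj G v w ≡ false →
    1 ≤ ∑[ u < n ] (⟦ lookup K u ⟧ * ⟦ not (adj G u w) ⟧)
  nonNeighbour⇒1≤∑ K {v} {w} v∈K ¬vw =
    ≤-trans (≤-reflexive (sym term≡1)) (term≤∑ (λ u → ⟦ lookup K u ⟧ * ⟦ not (adj G u w) ⟧) v)
    where
    term≡1 : ⟦ lookup K v ⟧ * ⟦ not (adj G v w) ⟧ ≡ 1
    term≡1 rewrite v∈K | ¬vw = refl

  commonNeighbour-or-blocked : ∀ K w →
    1 ≤ ⟦ commonNeighbour K w ⟧ + ∑[ v < n ] (⟦ lookup K v ⟧ * ⟦ not (adj G v w) ⟧)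
  commonNeighbour-or-blocked K w with lookup K w in w∈K
  ... | true = nonNeighbour⇒1≤∑ K w∈K (irrefl G w)  -- a vertex of K blocks itself
  ... | false with allB (λ v → not (lookup K v) ∨ adj G v w) (allFin n) in all
  ...   | true = s≤s z≤n
  ...   | false with allB-false _ (allFin n) all
  ...     | v , v-blocks = nonNeighbour⇒1≤∑ K (proj₁ (not-∨≡false v-blocks)) (proj₂ (not-∨≡false v-blocks))

  isCliqueAbove : ℕ → Subset n → Subset n → Bool
  isCliqueAbove s K T = K ⊆ᵇ T ∧ hasSize s T ∧ isClique G T

  cliquesContaining : ℕ → Subset n → ℕ
  cliquesContaining s K = sumˡ (map (λ T → ⟦ isCliqueAbove s K T ⟧) (allSubsets n))

  cliquesContaining-self : ∀ {s} K → IsClique K → ∣ K ∣ ≡ s → 1 ≤ cliquesContaining s K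
  cliquesContaining-self {s} K K-clique ∣K∣≡s =
    subst (_≤ cliquesContaining s K) (cong ⟦_⟧ K-counted) (∈⇒≤sum-map _ (∈-allSubsets K))
    where
    K-counted : isCliqueAbove s K K ≡ true
    K-counted rewrite ⊆ᵇ-refl K | hasSize-complete K ∣K∣≡s = isClique-complete K K-clique

  cliquesContaining-∅ : ∀ s → cliquesContaining s ∅ ≡ cliqueCount s G
  cliquesContaining-∅ s =
    trans (cong sumˡ (map-cong (λ T → cong (λ b → ⟦ b ∧ hasSize s T ∧ isClique G T ⟧) (∅⊆ᵇ T)) (allSubsets n)))
          (sym (length-filterᵇ _ (allSubsets n)))

  cliquesContaining-pair : ∀ s u v → cliquesContaining s (∅ [ u ]≔ true [ v ]≔ true) ≡ cliqueCountThrough s G u v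
  cliquesContaining-pair s u v =
    trans (cong sumˡ (map-cong contains-pair (allSubsets n))) (sym (length-filterᵇ _ (allSubsets n)))
    where
    contains-pair : ∀ T → ⟦ isCliqueAbove s (∅ [ u ]≔ true [ v ]≔ true) T ⟧
                        ≡ ⟦ lookup T u ∧ lookup T v ∧ hasSize s T ∧ isClique G T ⟧
    contains-pair T rewrite pair-⊆ᵇ u v T = cong ⟦_⟧ (∧-assoc (lookup T u) (lookup T v) _)

  cliquesContaining-[]≔true : ∀ s K →
    ∑[ w < n ] (⟦ not (lookup K w) ⟧ * cliquesContaining s (K [ w ]≔ true)) ≡ (s ∸ ∣ K ∣) * cliquesContaining s K
  cliquesContaining-[]≔true s K = begin
    ∑[ w < n ] (⟦ not (lookup K w) ⟧ * cliquesContaining s (K [ w ]≔ true))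
      ≡⟨ sum-cong-≗ (λ w → *-distribˡ-sum-map ⟦ not (lookup K w) ⟧ _ (allSubsets n)) ⟩
    ∑[ w < n ] sumˡ (map (pairs w) (allSubsets n))
      ≡⟨ sum-map-∑-comm (λ T w → pairs w T) (allSubsets n) ⟨
    sumˡ (map (λ T → ∑[ w < n ] pairs w T) (allSubsets n))
      ≡⟨ cong sumˡ (map-cong pairs-through (allSubsets n)) ⟩
    sumˡ (map (λ T → (s ∸ ∣ K ∣) * ⟦ isCliqueAbove s K T ⟧) (allSubsets n))
      ≡⟨ *-distribˡ-sum-map (s ∸ ∣ K ∣) _ (allSubsets n) ⟨
    (s ∸ ∣ K ∣) * cliquesContaining s K
      ∎
    where
    open ≡-Reasoning
    pairs : Fin n → Subset n → ℕ
    pairs w T = ⟦ not (lookup K w) ⟧ * ⟦ isCliqueAbove s (K [ w ]≔ true) T ⟧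
    pairs-through : ∀ T → ∑[ w < n ] pairs w T ≡ (s ∸ ∣ K ∣) * ⟦ isCliqueAbove s K T ⟧
    pairs-through T = begin
      ∑[ w < n ] pairs w T                                          ≡⟨ sum-cong-≗ regroup ⟩
      ∑[ w < n ] (⟦ b ⟧ * new w)                                    ≡⟨ *-distribˡ-sum ⟦ b ⟧ new ⟨
      ⟦ b ⟧ * ∑[ w < n ] new w                                      ≡⟨ ⟦⟧*-congʳ b #new ⟩
      ⟦ b ⟧ * (s ∸ ∣ K ∣)                                           ≡⟨ *-comm ⟦ b ⟧ _ ⟩
      (s ∸ ∣ K ∣) * ⟦ b ⟧                                           ∎
      where
      b = isCliqueAbove s K T
      c = hasSize s T ∧ isClique G T
      new : Fin n → ℕ
      new w = ⟦ not (lookup K w) ⟧ * ⟦ lookup T w ⟧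
      regroup : ∀ w → pairs w T ≡ ⟦ b ⟧ * new w
      regroup w rewrite []≔true-⊆ᵇ K T w | ⟦∧⟧ (K ⊆ᵇ T ∧ lookup T w) c | ⟦∧⟧ (K ⊆ᵇ T) (lookup T w) | ⟦∧⟧ (K ⊆ᵇ T) c =
        rearrange ⟦ not (lookup K w) ⟧ ⟦ K ⊆ᵇ T ⟧ ⟦ lookup T w ⟧ ⟦ c ⟧
        where
        rearrange : ∀ x a t y → x * (a * t * y) ≡ a * y * (x * t)
        rearrange = solve-∀
      #new : b ≡ true → ∑[ w < n ] new w ≡ s ∸ ∣ K ∣
      #new b≡true = begin
        ∑[ w < n ] new w                   ≡⟨ m+n∸n≡m _ ∣ K ∣ ⟨
        ∑[ w < n ] new w + ∣ K ∣ ∸ ∣ K ∣   ≡⟨ cong (_∸ ∣ K ∣) (⊆ᵇ⇒∑+∣∣≡∣∣ K T K⊆T) ⟩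
        ∣ T ∣ ∸ ∣ K ∣                      ≡⟨ cong (_∸ ∣ K ∣) (hasSize-sound T sized) ⟩
        s ∸ ∣ K ∣                          ∎
        where
        K⊆T = proj₁ (∧≡true {K ⊆ᵇ T} b≡true)
        sized = proj₁ (∧≡true {hasSize s T} (proj₂ (∧≡true {K ⊆ᵇ T} b≡true)))

  cliqueCountThrough≤js : ∀ r {u v} → adj G u v ≡ true → cliqueCountThrough (suc r) G u v ≤ js r G
  cliqueCountThrough≤js r {u} {v} uv =
    subst (_≤ js r G) (cong (λ b → if b then cliqueCountThrough (suc r) G u v else 0) uv)
    (∈⇒≤foldr-⊔ (∈-concatMap⁺ row (lose (∈-allFin u) (∈-map⁺ (entry u) (∈-allFin v)))))
    where
    entry : Fin n → Fin n → ℕ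
    entry u v = if adj G u v then cliqueCountThrough (suc r) G u v else 0
    row : Fin n → List ℕ
    row u = map (entry u) (allFin n)

  module MinimumDegree (0<n : 0 < n) where

    v₀ : Fin n
    v₀ = argmin (degree G) (fromℕ< 0<n) (allFin n)

    D : ℕ
    D = n ∸ degree G v₀

    missing≤D : ∀ v → n ∸ degree G v ≤ D
    missing≤D v =
      ∸-monoʳ-≤ n (All.lookup (f[argmin]≤f[xs] {f = degree G} (fromℕ< 0<n) (allFin n)) (∈-allFin v))

    degree+D≡n : degree G v₀ + D ≡ n
    degree+D≡n = m+[n∸m]≡n (degree≤n v₀)

  module _ {D : ℕ} (missing≤D : ∀ v → n ∸ degree G v ≤ D) where

    commonNeighbours-≥ : ∀ K → n ∸ ∣ K ∣ * D ≤ ∑[ w < n ] ⟦ commonNeighbour K w ⟧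
    commonNeighbours-≥ K = m≤n+o⇒m∸n≤o n (∣ K ∣ * D) (begin
      n
        ≡⟨ ∑[1]≡n n ⟨
      ∑[ w < n ] 1
        ≤⟨ ∑-mono-≤ (commonNeighbour-or-blocked K) ⟩
      ∑[ w < n ] (⟦ commonNeighbour K w ⟧ + ∑[ v < n ] blocks v w)
        ≡⟨ ∑-distrib-+ (λ w → ⟦ commonNeighbour K w ⟧) _ ⟩
      #common + ∑[ w < n ] ∑[ v < n ] blocks v w
        ≡⟨ cong (#common +_) (∑-comm (λ w v → blocks v w)) ⟩
      #common + ∑[ v < n ] ∑[ w < n ] blocks v w
        ≡⟨ cong (#common +_) (sum-cong-≗ λ v → *-distribˡ-sum ⟦ lookup K v ⟧ (λ w → ⟦ not (adj G v w) ⟧)) ⟨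
      #common + ∑[ v < n ] (⟦ lookup K v ⟧ * ∑[ w < n ] ⟦ not (adj G v w) ⟧)
        ≤⟨ +-monoʳ-≤ #common (∑-mono-≤ λ v → *-monoʳ-≤ ⟦ lookup K v ⟧ (nonNeighbours≤D v)) ⟩
      #common + ∑[ v < n ] (⟦ lookup K v ⟧ * D)
        ≡⟨ cong (#common +_) (*-distribʳ-sum D (λ v → ⟦ lookup K v ⟧)) ⟨
      #common + ∑[ v < n ] ⟦ lookup K v ⟧ * D
        ≡⟨ cong (λ k → #common + k * D) (∣∣≡∑ K) ⟨
      #common + ∣ K ∣ * D
        ≡⟨ +-comm #common _ ⟩
      ∣ K ∣ * D + #common
        ∎)
      where
      open ≤-Reasoning
      #common = ∑[ w < n ] ⟦ commonNeighbour K w ⟧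
      blocks : Fin n → Fin n → ℕ
      blocks v w = ⟦ lookup K v ⟧ * ⟦ not (adj G v w) ⟧
      nonNeighbours≤D : ∀ v → ∑[ w < n ] ⟦ not (adj G v w) ⟧ ≤ D
      nonNeighbours≤D v = ≤-trans (≤-reflexive (nonNeighbours≡ v)) (missing≤D v)

    cliquesContaining-≥ : ∀ {s} m K → IsClique K → ∣ K ∣ + m ≡ s →
      stepProduct n D ∣ K ∣ m ≤ m ! * cliquesContaining s K
    cliquesContaining-≥ zero K K-clique ∣K∣+0≡s =
      subst (1 ≤_) (sym (+-identityʳ _)) (cliquesContaining-self K K-clique (trans (sym (+-identityʳ _)) ∣K∣+0≡s))
    cliquesContaining-≥ {s} (suc m) K K-clique ∣K∣+m+1≡s = begin
      (n ∸ ∣ K ∣ * D) * P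
        ≤⟨ *-monoˡ-≤ P (commonNeighbours-≥ K) ⟩
      (∑[ w < n ] ⟦ commonNeighbour K w ⟧) * P
        ≡⟨ *-distribʳ-sum P (λ w → ⟦ commonNeighbour K w ⟧) ⟩
      ∑[ w < n ] (⟦ commonNeighbour K w ⟧ * P)
        ≤⟨ ∑-mono-≤ (λ w → ⟦⟧*-monoʳ-≤ _ (extend w)) ⟩
      ∑[ w < n ] (⟦ commonNeighbour K w ⟧ * (m ! * C w))
        ≤⟨ ∑-mono-≤ (λ w → *-monoˡ-≤ (m ! * C w) (⟦∧⟧≤⟦⟧ (not (lookup K w)) _)) ⟩
      ∑[ w < n ] (⟦ not (lookup K w) ⟧ * (m ! * C w))
        ≡⟨ sum-cong-≗ (λ w → x*[y*z]≡y*[x*z] ⟦ not (lookup K w) ⟧ (m !) (C w)) ⟩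
      ∑[ w < n ] (m ! * (⟦ not (lookup K w) ⟧ * C w))
        ≡⟨ *-distribˡ-sum (m !) (λ w → ⟦ not (lookup K w) ⟧ * C w) ⟨
      m ! * ∑[ w < n ] (⟦ not (lookup K w) ⟧ * C w)
        ≡⟨ cong (m ! *_) (cliquesContaining-[]≔true s K) ⟩
      m ! * ((s ∸ ∣ K ∣) * cliquesContaining s K)
        ≡⟨ cong (λ k → m ! * (k * cliquesContaining s K)) s∸∣K∣≡1+m ⟩
      m ! * (suc m * cliquesContaining s K)
        ≡⟨ trans (x*[y*z]≡y*[x*z] (m !) (suc m) _) (sym (*-assoc (suc m) (m !) _)) ⟩
      suc m ! * cliquesContaining s K
        ∎
      where
      open ≤-Reasoning
      P = stepProduct n D (suc ∣ K ∣) m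
      C : Fin n → ℕ
      C w = cliquesContaining s (K [ w ]≔ true)
      x*[y*z]≡y*[x*z] : ∀ x y z → x * (y * z) ≡ y * (x * z)
      x*[y*z]≡y*[x*z] = solve-∀
      s∸∣K∣≡1+m : s ∸ ∣ K ∣ ≡ suc m
      s∸∣K∣≡1+m = trans (cong (_∸ ∣ K ∣) (sym ∣K∣+m+1≡s)) (m+n∸m≡n ∣ K ∣ (suc m))
      extend : ∀ w → commonNeighbour K w ≡ true → P ≤ m ! * C w
      extend w cn with commonNeighbour-sound K w cn
      ... | w∉K , joins = subst (λ k → stepProduct n D k m ≤ m ! * C w) ∣K+w∣≡1+∣K∣
        (cliquesContaining-≥ m (K [ w ]≔ true) (IsClique-[]≔true {K} K-clique joins)
                             (trans (cong (_+ m) ∣K+w∣≡1+∣K∣) (trans (sym (+-suc ∣ K ∣ m)) ∣K∣+m+1≡s)))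
        where
        ∣K+w∣≡1+∣K∣ = ∣[]≔true∣ K w w∉K

    cliqueCount-≥ : ∀ s → stepProduct n D 0 s ≤ s ! * cliqueCount s G
    cliqueCount-≥ s = subst₂ (λ k c → stepProduct n D k s ≤ s ! * c) (∣⊥∣≡0 n) (cliquesContaining-∅ s)
      (cliquesContaining-≥ s ∅ ∅-isClique (cong (_+ s) (∣⊥∣≡0 n)))

    cliqueCountThrough-≥ : ∀ {u v} m → adj G u v ≡ true →
      stepProduct n D 2 m ≤ m ! * cliqueCountThrough (2 + m) G u v
    cliqueCountThrough-≥ {u} {v} m uv =
      subst₂ (λ k c → stepProduct n D k m ≤ m ! * c) ∣uv∣≡2 (cliquesContaining-pair (2 + m) u v)
        (cliquesContaining-≥ m (∅ [ u ]≔ true [ v ]≔ true) uv-isClique (cong (_+ m) ∣uv∣≡2))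
      where
      ∅-joins : ∀ {x y} → lookup ∅ x ≡ true → adj G x y ≡ true
      ∅-joins {x} x∈∅ = contradiction x∈∅ (∉∅ x)
      ⁅u⁆-joins-v : ∀ {x} → lookup (∅ [ u ]≔ true) x ≡ true → adj G x v ≡ true
      ⁅u⁆-joins-v {x} x∈ with lookup-[]≔true ∅ u x x∈
      ... | inj₁ refl = uv
      ... | inj₂ x∈∅ = ∅-joins x∈∅
      uv-isClique : IsClique (∅ [ u ]≔ true [ v ]≔ true)
      uv-isClique = IsClique-[]≔true {∅ [ u ]≔ true} (IsClique-[]≔true {∅} ∅-isClique ∅-joins) ⁅u⁆-joins-v
      v≢u : v ≢ u
      v≢u refl = contradiction (trans (sym uv) (irrefl G u)) λ ()
      ∣uv∣≡2 : ∣ ∅ [ u ]≔ true [ v ]≔ true ∣ ≡ 2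
      ∣uv∣≡2 =
        trans (∣[]≔true∣ (∅ [ u ]≔ true) v (trans (lookup∘update′ v≢u ∅ true) (lookup-replicate v false)))
              (cong suc (trans (∣[]≔true∣ ∅ u (lookup-replicate u false)) (cong suc (∣⊥∣≡0 n))))

module IntegerBounds where

  open import Defs using (Graph; degree; cliqueCount; js)
  open StepProduct
  open import Data.Fin using (fromℕ<)
  open import Data.Nat using (ℕ; suc; _+_; _*_; _∸_; _^_; _≤_; _<_; _!; z≤n; s≤s; NonZero; >-nonZero)
  open import Data.Nat.Properties
  open import Data.Nat.Tactic.RingSolver using (solve-∀)
  open import Data.Product using (proj₂)
  open import Relation.Binary.PropositionalEquality

  extension-bound : ∀ {n D r N} j m → j + m ≡ r → r * D ≤ n → stepProduct n D j (suc m) ≤ suc m ! * N →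
    n ^ m * (n ∸ r * D) ≤ r ^ m * (suc m * N)
  extension-bound {n} {D} {N = N} j m refl rD≤n extensions = *-cancelʳ-≤ _ _ (m !) {{m !≢0}} (begin
    n ^ m * E * m !                      ≡⟨ x*y*z≡x*z*y (n ^ m) E (m !) ⟩
    n ^ m * m ! * E                      ≤⟨ *-monoˡ-≤ E (stepProduct-≥ j m refl rD≤n) ⟩
    r ^ m * stepProduct n D j m * E      ≡⟨ *-assoc (r ^ m) _ E ⟩
    r ^ m * (stepProduct n D j m * E)    ≡⟨ cong (r ^ m *_) (stepProduct-suc n D j m) ⟨
    r ^ m * stepProduct n D j (suc m)    ≤⟨ *-monoʳ-≤ (r ^ m) extensions ⟩
    r ^ m * (suc m * m ! * N)            ≡⟨ regroup (r ^ m) (suc m) (m !) N ⟩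
    r ^ m * (suc m * N) * m !            ∎)
    where
    open ≤-Reasoning
    r = j + m
    E = n ∸ r * D
    x*y*z≡x*z*y : ∀ x y z → x * y * z ≡ x * z * y
    x*y*z≡x*z*y = solve-∀
    regroup : ∀ a b c d → a * (b * c * d) ≡ a * (b * d) * c
    regroup = solve-∀

  margin-bound : ∀ {a Q E n m r N} .{{_ : NonZero n}} → a < Q * E → n ^ m * E ≤ r ^ m * (suc m * N) →
    a * n ^ m < N * (Q * suc m * r ^ m)
  margin-bound {a} {Q} {E} {n} {m} {r} {N} a<QE extensions = begin-strict
    a * n ^ m                    <⟨ *-monoˡ-< (n ^ m) {{m^n≢0 n m}} a<QE ⟩
    Q * E * n ^ m                ≡⟨ x*y*z≡x*[z*y] Q E (n ^ m) ⟩
    Q * (n ^ m * E)              ≤⟨ *-monoʳ-≤ Q extensions ⟩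
    Q * (r ^ m * (suc m * N))    ≡⟨ regroup Q (r ^ m) (suc m) N ⟩
    N * (Q * suc m * r ^ m)      ∎
    where
    open ≤-Reasoning
    x*y*z≡x*[z*y] : ∀ x y z → x * y * z ≡ x * (z * y)
    x*y*z≡x*[z*y] = solve-∀
    regroup : ∀ q p s k → q * (p * (s * k)) ≡ k * (q * s * p)
    regroup = solve-∀

  rD<n : ∀ P Q {r n D} → P * r * n < Q * (n ∸ r * D) → r * D < n
  rD<n P Q {r} {n} margin =
    m∸n≢0⇒n<m λ E≡0 → n≮0 (subst (P * r * n <_) (trans (cong (Q *_) E≡0) (*-zeroʳ Q)) margin)

  module _ {n : ℕ} (G : Graph n) {D : ℕ} (missing≤D : ∀ v → n ∸ degree G v ≤ D) where

    open Cliques G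

    cliqueCount-bound : ∀ {r P Q} → 1 ≤ r → P * r * n < Q * (n ∸ r * D) →
      P * r * n ^ suc r < cliqueCount (suc r) G * (Q * suc r * r ^ suc r)
    cliqueCount-bound {r} {P} {Q} 1≤r margin = begin-strict
      P * r * n ^ suc r
        ≡⟨ *-assoc (P * r) n (n ^ r) ⟨
      P * r * n * n ^ r
        <⟨ margin-bound {Q = Q} {m = r} {r} {k} {{>-nonZero 0<n}} margin extensions ⟩
      k * (Q * suc r * r ^ r)
        ≤⟨ *-monoʳ-≤ k (*-monoʳ-≤ (Q * suc r) (m≤n*m (r ^ r) r {{>-nonZero 1≤r}})) ⟩
      k * (Q * suc r * r ^ suc r)
        ∎
      where
      open ≤-Reasoning
      k = cliqueCount (suc r) G
      rD<n′ : r * D < n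
      rD<n′ = rD<n P Q margin
      0<n : 0 < n
      0<n = ≤-<-trans z≤n rD<n′
      extensions : n ^ r * (n ∸ r * D) ≤ r ^ r * (suc r * k)
      extensions = extension-bound 0 r refl (<⇒≤ rD<n′) (cliqueCount-≥ missing≤D (suc r))

    js-bound : ∀ {r P Q} → 2 ≤ r → P * r * n < Q * (n ∸ r * D) →
      P * n ^ (r ∸ 2) < js r G * (Q * r ^ (r ∸ 2))
    js-bound {r@(suc (suc t))} {P} {Q} (s≤s (s≤s _)) margin = *-cancelʳ-< (suc t) _ _ (begin-strict
      P * n ^ t * suc t
        ≤⟨ *-monoʳ-≤ (P * n ^ t) 1+t≤rn ⟩
      P * n ^ t * (r * n)
        ≡⟨ regroup P (n ^ t) r n ⟩
      P * r * n * n ^ t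
        <⟨ margin-bound {Q = Q} {m = t} {r} {M} {{>-nonZero 0<n}} margin extensions ⟩
      M * (Q * suc t * r ^ t)
        ≡⟨ x*[y*z*w]≡x*[y*w]*z M Q (suc t) (r ^ t) ⟩
      M * (Q * r ^ t) * suc t
        ∎)
      where
      open ≤-Reasoning
      M = js r G
      rD<n′ : r * D < n
      rD<n′ = rD<n P Q {D = D} margin
      0<n : 0 < n
      0<n = ≤-<-trans z≤n rD<n′
      1+t≤rn : suc t ≤ r * n
      1+t≤rn = ≤-trans (n≤1+n (suc t)) (m≤m*n r n {{>-nonZero 0<n}})
      u = fromℕ< 0<n
      0<deg : 0 < degree G u
      0<deg = ∸-cancelʳ-< (≤-<-trans (missing≤D u) (≤-<-trans (m≤n*m D r) rD<n′))
      edge = neighbour u 0<deg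
      extensions : n ^ t * (n ∸ r * D) ≤ r ^ t * (suc t * M)
      extensions = extension-bound {D = D} 2 t refl (<⇒≤ rD<n′)
        (≤-trans (cliqueCountThrough-≥ missing≤D (suc t) (proj₂ edge))
                 (*-monoʳ-≤ (suc t !) (cliqueCountThrough≤js r (proj₂ edge))))
      regroup : ∀ p x r n → p * x * (r * n) ≡ p * r * n * x
      regroup = solve-∀
      x*[y*z*w]≡x*[y*w]*z : ∀ x y z w → x * (y * z * w) ≡ x * (y * w) * z
      x*[y*z*w]≡x*[y*w]*z = solve-∀

module Fractions where

  open import Defs using (frac; ℕ→ℚ; pow)
  open import Data.Integer as ℤ using (+_; -[1+_]; +<+)
  import Data.Integer.Properties as ℤ
  open import Data.Integer.Tactic.RingSolver using (solve-∀)
  open import Data.Nat using (ℕ; zero; suc; _+_; _*_; _∸_; _^_; _≤_; _<_; z≤n; s≤s; z<s)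
  open import Data.Nat.Properties
    using (*-identityʳ; *-zeroʳ; n≮0; +-monoˡ-<; +-cancelʳ-<; m+n≤o⇒m≤o∸n; *-distribˡ-∸)
  import Data.Nat.Tactic.RingSolver as ℕ
  open import Data.Rational as ℚ using (ℚ; mkℚ; toℚᵘ; 0ℚ)
  import Data.Rational.Properties as ℚ
  open import Data.Rational.Unnormalised as ℚᵘ using (ℚᵘ; mkℚᵘ; *≡*; *<*)
  open import Function.Bundles using (_⇔_; mk⇔; Equivalence)
  open import Relation.Binary.PropositionalEquality
  open import Relation.Nullary using (contradiction)

  -- p = a / b by cross-multiplication; for b = 0 it only says that a = 0.
  infix 4 _≃_÷_
  record _≃_÷_ (p : ℚᵘ) (a b : ℕ) : Set where
    constructor cross
    field
      cross-≡ : ℚᵘ.↥ p ℤ.* + b ≡ + a ℤ.* ℚᵘ.↧ p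

  ÷-resp-≃ : ∀ {p q a b} → p ℚᵘ.≃ q → q ≃ a ÷ b → p ≃ a ÷ b
  ÷-resp-≃ {mkℚᵘ i _} {mkℚᵘ j _} {a} {b} (*≡* i*Y≡j*X) (cross j*b≡a*Y) =
    cross (ℤ.*-cancelʳ-≡ _ _ Y (begin
    i ℤ.* + b ℤ.* Y   ≡⟨ x*y*z≡x*z*y i (+ b) Y ⟩
    i ℤ.* Y ℤ.* + b   ≡⟨ cong (ℤ._* + b) i*Y≡j*X ⟩
    j ℤ.* X ℤ.* + b   ≡⟨ x*y*z≡x*z*y j X (+ b) ⟩
    j ℤ.* + b ℤ.* X   ≡⟨ cong (ℤ._* X) j*b≡a*Y ⟩
    + a ℤ.* Y ℤ.* X   ≡⟨ x*y*z≡x*z*y (+ a) Y X ⟩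
    + a ℤ.* X ℤ.* Y   ∎))
    where
    open ≡-Reasoning
    X = ℚᵘ.↧ (mkℚᵘ i _)
    Y = ℚᵘ.↧ (mkℚᵘ j _)
    x*y*z≡x*z*y : ∀ x y z → x ℤ.* y ℤ.* z ≡ x ℤ.* z ℤ.* y
    x*y*z≡x*z*y = solve-∀

  *-÷ : ∀ {x y a b c d} → toℚᵘ x ≃ a ÷ b → toℚᵘ y ≃ c ÷ d → toℚᵘ (x ℚ.* y) ≃ a * c ÷ (b * d)
  *-÷ {x@(mkℚ i _ _)} {y@(mkℚ j _ _)} {a} {b} {c} {d} (cross i*b≡a*X) (cross j*d≡c*Y) =
    ÷-resp-≃ (ℚ.toℚᵘ-homo-* x y) (cross (begin
      i ℤ.* j ℤ.* + (b * d)            ≡⟨ cong (i ℤ.* j ℤ.*_) (ℤ.pos-* b d) ⟩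
      i ℤ.* j ℤ.* (+ b ℤ.* + d)        ≡⟨ interchange i j (+ b) (+ d) ⟩
      i ℤ.* + b ℤ.* (j ℤ.* + d)        ≡⟨ cong₂ ℤ._*_ i*b≡a*X j*d≡c*Y ⟩
      + a ℤ.* X ℤ.* (+ c ℤ.* Y)        ≡⟨ interchange (+ a) X (+ c) Y ⟩
      + a ℤ.* + c ℤ.* (X ℤ.* Y)        ≡⟨ cong (ℤ._* (X ℤ.* Y)) (ℤ.pos-* a c) ⟨
      + (a * c) ℤ.* (X ℤ.* Y)          ∎))
    where
    open ≡-Reasoning
    X = ℚ.↧ x
    Y = ℚ.↧ y
    interchange : ∀ p q r s → p ℤ.* q ℤ.* (r ℤ.* s) ≡ p ℤ.* r ℤ.* (q ℤ.* s)
    interchange = solve-∀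

  +-÷ : ∀ {x y a b c d} → toℚᵘ x ≃ a ÷ b → toℚᵘ y ≃ c ÷ d → toℚᵘ (x ℚ.+ y) ≃ a * d + c * b ÷ (b * d)
  +-÷ {x@(mkℚ i _ _)} {y@(mkℚ j _ _)} {a} {b} {c} {d} (cross i*b≡a*X) (cross j*d≡c*Y) =
    ÷-resp-≃ (ℚ.toℚᵘ-homo-+ x y) (cross (begin
      (i ℤ.* Y ℤ.+ j ℤ.* X) ℤ.* + (b * d)                  ≡⟨ cong ((i ℤ.* Y ℤ.+ j ℤ.* X) ℤ.*_) (ℤ.pos-* b d) ⟩
      (i ℤ.* Y ℤ.+ j ℤ.* X) ℤ.* (+ b ℤ.* + d)              ≡⟨ expand i j X Y (+ b) (+ d) ⟩
      i ℤ.* + b ℤ.* (Y ℤ.* + d) ℤ.+ j ℤ.* + d ℤ.* (X ℤ.* + b)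
        ≡⟨ cong₂ (λ p q → p ℤ.* (Y ℤ.* + d) ℤ.+ q ℤ.* (X ℤ.* + b)) i*b≡a*X j*d≡c*Y ⟩
      + a ℤ.* X ℤ.* (Y ℤ.* + d) ℤ.+ + c ℤ.* Y ℤ.* (X ℤ.* + b) ≡⟨ collect (+ a) (+ c) X Y (+ b) (+ d) ⟩
      (+ a ℤ.* + d ℤ.+ + c ℤ.* + b) ℤ.* (X ℤ.* Y)           ≡⟨ cong (ℤ._* (X ℤ.* Y)) numerator ⟨
      + (a * d + c * b) ℤ.* (X ℤ.* Y)                       ∎))
    where
    open ≡-Reasoning
    X = ℚ.↧ x
    Y = ℚ.↧ y
    numerator : + (a * d + c * b) ≡ + a ℤ.* + d ℤ.+ + c ℤ.* + b
    numerator = trans (ℤ.pos-+ (a * d) (c * b)) (cong₂ ℤ._+_ (ℤ.pos-* a d) (ℤ.pos-* c b))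
    expand : ∀ i j X Y b d →
      (i ℤ.* Y ℤ.+ j ℤ.* X) ℤ.* (b ℤ.* d) ≡ i ℤ.* b ℤ.* (Y ℤ.* d) ℤ.+ j ℤ.* d ℤ.* (X ℤ.* b)
    expand = solve-∀
    collect : ∀ a c X Y b d →
      a ℤ.* X ℤ.* (Y ℤ.* d) ℤ.+ c ℤ.* Y ℤ.* (X ℤ.* b) ≡ (a ℤ.* d ℤ.+ c ℤ.* b) ℤ.* (X ℤ.* Y)
    collect = solve-∀

  frac-÷ : ∀ a b → 0 < b → toℚᵘ (frac a b) ≃ a ÷ b
  frac-÷ a (suc b) _ with ℚ.toℚᵘ-fromℚᵘ (mkℚᵘ (+ a) b)
  ... | *≡* a/b≃a/b = cross a/b≃a/b

  ℕ→ℚ-÷ : ∀ a → toℚᵘ (ℕ→ℚ a) ≃ a ÷ 1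
  ℕ→ℚ-÷ a = frac-÷ a 1 z<s

  *ℕ→ℚ-÷ : ∀ {x a b} m → toℚᵘ x ≃ a ÷ b → toℚᵘ (x ℚ.* ℕ→ℚ m) ≃ a * m ÷ b
  *ℕ→ℚ-÷ {x} {a} {b} m x≃a/b = subst (toℚᵘ (x ℚ.* ℕ→ℚ m) ≃ a * m ÷_) (*-identityʳ b) (*-÷ x≃a/b (ℕ→ℚ-÷ m))

  pow-÷ : ∀ {x a b} → toℚᵘ x ≃ a ÷ b → ∀ k → toℚᵘ (pow x k) ≃ a ^ k ÷ b ^ k
  pow-÷ x≃a/b zero = cross refl
  pow-÷ x≃a/b (suc k) = *-÷ x≃a/b (pow-÷ x≃a/b k)

  positive-÷ : ∀ {c} → 0ℚ ℚ.< c → toℚᵘ c ≃ ℤ.∣ ℚ.↥ c ∣ ÷ ℚ.↧ₙ c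
  positive-÷ {mkℚ (+ _) _ _} _ = cross refl
  positive-÷ {mkℚ -[1+ _ ] _ _} (ℚ.*<* ())

  ÷-<-⇔ : ∀ {p q a b c d} → p ≃ a ÷ b → q ≃ c ÷ d → 0 < b → 0 < d → (p ℚᵘ.< q ⇔ a * d < c * b)
  ÷-<-⇔ {mkℚᵘ i _} {mkℚᵘ j _} {a} {suc b′} {c} {suc d′} (cross i*B≡a*X) (cross j*D≡c*Y) _ _ = mk⇔
    (λ { (*<* i*Y<j*X) → ℤ.drop‿+<+ (ℤ.*-cancelʳ-<-nonNeg (X ℤ.* Y)
                           (subst₂ ℤ._<_ lhs rhs (ℤ.*-monoʳ-<-pos (B ℤ.* D) i*Y<j*X))) })
    (λ ad<cb → *<* (ℤ.*-cancelʳ-<-nonNeg (B ℤ.* D)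
                      (subst₂ ℤ._<_ (sym lhs) (sym rhs) (ℤ.*-monoʳ-<-pos (X ℤ.* Y) (+<+ ad<cb)))))
    where
    X = ℚᵘ.↧ (mkℚᵘ i _)
    Y = ℚᵘ.↧ (mkℚᵘ j _)
    B = + suc b′
    D = + suc d′
    rescale : ∀ {i a B X} Y D → i ℤ.* B ≡ a ℤ.* X → i ℤ.* Y ℤ.* (B ℤ.* D) ≡ a ℤ.* D ℤ.* (X ℤ.* Y)
    rescale {i} {a} {B} {X} Y D i*B≡a*X = begin
      i ℤ.* Y ℤ.* (B ℤ.* D)   ≡⟨ interchange i Y B D ⟩
      i ℤ.* B ℤ.* (Y ℤ.* D)   ≡⟨ cong (ℤ._* (Y ℤ.* D)) i*B≡a*X ⟩
      a ℤ.* X ℤ.* (Y ℤ.* D)   ≡⟨ rotate a X Y D ⟩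
      a ℤ.* D ℤ.* (X ℤ.* Y)   ∎
      where
      open ≡-Reasoning
      interchange : ∀ p q r s → p ℤ.* q ℤ.* (r ℤ.* s) ≡ p ℤ.* r ℤ.* (q ℤ.* s)
      interchange = solve-∀
      rotate : ∀ p q r s → p ℤ.* q ℤ.* (r ℤ.* s) ≡ p ℤ.* s ℤ.* (q ℤ.* r)
      rotate = solve-∀
    lhs : i ℤ.* Y ℤ.* (B ℤ.* D) ≡ + (a * suc d′) ℤ.* (X ℤ.* Y)
    lhs = trans (rescale {i} {+ a} Y D i*B≡a*X) (cong (ℤ._* (X ℤ.* Y)) (sym (ℤ.pos-* a (suc d′))))
    rhs : j ℤ.* X ℤ.* (B ℤ.* D) ≡ + (c * suc b′) ℤ.* (X ℤ.* Y)
    rhs = trans (cong (j ℤ.* X ℤ.*_) (ℤ.*-comm B D))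
            (trans (rescale {j} {+ c} X B j*D≡c*Y)
                   (cong₂ ℤ._*_ (sym (ℤ.pos-* c (suc b′))) (ℤ.*-comm Y X)))

  <ℕ→ℚ⇒ : ∀ {x a b} k → toℚᵘ x ≃ a ÷ b → 0 < b → x ℚ.< ℕ→ℚ k → a < k * b
  <ℕ→ℚ⇒ {a = a} {b} k x≃a/b 0<b x<k =
    subst (_< k * b) (*-identityʳ a)
      (Equivalence.to (÷-<-⇔ x≃a/b (ℕ→ℚ-÷ k) 0<b z<s) (ℚ.toℚᵘ-mono-< x<k))

  ⇒<ℕ→ℚ : ∀ {x a b} k → toℚᵘ x ≃ a ÷ b → a < k * b → x ℚ.< ℕ→ℚ k
  ⇒<ℕ→ℚ {a = a} {zero} k _ a<k*0 = contradiction (subst (a <_) (*-zeroʳ k) a<k*0) n≮0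
  ⇒<ℕ→ℚ {a = a} {suc b} k x≃a/b a<kb =
    ℚ.toℚᵘ-cancel-< (Equivalence.from (÷-<-⇔ x≃a/b (ℕ→ℚ-÷ k) z<s z<s)
                                      (subst (_< k * suc b) (sym (*-identityʳ a)) a<kb))

  minDegree-margin : ∀ {r c n δ D} → 1 ≤ r → 0ℚ ℚ.< c →
    (frac (r ∸ 1) r ℚ.+ c) ℚ.* ℕ→ℚ n ℚ.< ℕ→ℚ δ → δ + D ≡ n →
    ℤ.∣ ℚ.↥ c ∣ * r * n < ℚ.↧ₙ c * (n ∸ r * D)
  minDegree-margin {suc r′} {c} {_} {δ} {D} (s≤s z≤n) 0<c hyp refl =
    subst (P * r * n <_) (sym (*-distribˡ-∸ Q n (r * D))) (m+n≤o⇒m≤o∸n (suc (P * r * n)) margin)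
    where
    P = ℤ.∣ ℚ.↥ c ∣
    Q = ℚ.↧ₙ c
    r = suc r′
    n = δ + D
    cleared : (r′ * Q + P * r) * n < δ * (r * Q)
    cleared = <ℕ→ℚ⇒ δ (*ℕ→ℚ-÷ n (+-÷ (frac-÷ r′ r z<s) (positive-÷ 0<c))) z<s hyp
    margin : P * r * n + Q * (r * D) < Q * n
    margin = +-cancelʳ-< (r′ * Q * n) _ _
      (subst₂ _<_ (lhs r′ Q P δ D) (rhs r′ Q δ D) (+-monoˡ-< (Q * (r * D)) cleared))
      where
      lhs : ∀ r′ Q P δ D → (r′ * Q + P * suc r′) * (δ + D) + Q * (suc r′ * D)
                         ≡ P * suc r′ * (δ + D) + Q * (suc r′ * D) + r′ * Q * (δ + D)
      lhs = ℕ.solve-∀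
      rhs : ∀ r′ Q δ D → δ * (suc r′ * Q) + Q * (suc r′ * D) ≡ Q * (δ + D) + r′ * Q * (δ + D)
      rhs = ℕ.solve-∀

open import Defs using (frac; ℕ→ℚ; pow; degree; cliqueCount; js)
open import Data.Nat using (ℕ; _≤_; suc; _∸_)
open import Data.Fin using (Fin)
open import Data.Product using (_×_; _,_)
open import Data.Rational using (ℚ; _<_; _+_; _*_; 0ℚ)

import Data.Integer as ℤ
import Data.Nat as ℕ
open import Data.Nat.Properties using (≤-trans)
import Data.Rational as ℚ
open Fractions
open IntegerBounds

corollary2 : (r : ℕ) → 3 ≤ r → (c : ℚ) → 0ℚ < c →
    (n : ℕ) → 1 ≤ n → (G : Graph n) →
    (∀ (v : Fin n) → (frac (r ∸ 1) r + c) * ℕ→ℚ n < ℕ→ℚ (degree G v)) →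
    (c * frac r (suc r) * pow (frac n r) (suc r) < ℕ→ℚ (cliqueCount (suc r) G))
    × (c * pow (frac n r) (r ∸ 2) < ℕ→ℚ (js r G))
corollary2 r 3≤r c 0<c n 1≤n G hyp =
    ⇒<ℕ→ℚ (cliqueCount (suc r) G) (*-÷ (*-÷ c≃P/Q (frac-÷ r (suc r) ℕ.z<s)) (pow-÷ n/r (suc r)))
      (cliqueCount-bound G missing≤D {P = P} {Q} 1≤r margin)
  , ⇒<ℕ→ℚ (js r G) (*-÷ c≃P/Q (pow-÷ n/r (r ∸ 2))) (js-bound G missing≤D {P = P} {Q} 2≤r margin)
  where
  open Cliques.MinimumDegree G 1≤n
  P Q : ℕ
  P = ℤ.∣ ℚ.↥ c ∣
  Q = ℚ.↧ₙ c
  1≤r : 1 ≤ r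
  1≤r = ≤-trans (ℕ.s≤s ℕ.z≤n) 3≤r
  2≤r : 2 ≤ r
  2≤r = ≤-trans (ℕ.s≤s (ℕ.s≤s ℕ.z≤n)) 3≤r
  c≃P/Q : ℚ.toℚᵘ c ≃ P ÷ Q
  c≃P/Q = positive-÷ 0<c
  n/r : ℚ.toℚᵘ (frac n r) ≃ n ÷ r
  n/r = frac-÷ n r 1≤r
  margin : P ℕ.* r ℕ.* n ℕ.< Q ℕ.* (n ∸ r ℕ.* D)
  margin = minDegree-margin 1≤r 0<c (hyp v₀) degree+D≡n
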